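{- Let $G=(V,E)$ be a graph with $n=|V|$ and let $\pi$ be a 2-partition of $V$ such that $h_1(\pi)\le h_1(\pi\ominus \{v\})$ for every vertex $v\in V$. Then $c_\pi(v)\le (n-1)/2$ for every $v\in V$.
   Context: A 2-partition of $V$ is an unordered pair $\pi=(V_1,V_2)$ with $V_1\cap V_2=\emptyset$, $V_1\cup V_2=V$ (clusters may be empty). Two distinct vertices $u,v$ are in conflict in $\pi$ if they are in the same cluster and $(u,v)\notin E$, or in different clusters and $(u,v)\in E$; $c_\pi(v)$ is the number of vertices in conflict with $v$, and $h_1(\pi)=\sum_{v\in V}c_\pi(v)$. For $F\subseteq V$, $\pi\ominus F=(V_1\ominus F,V_2\ominus F)$ ($\ominus$ = symmetric difference), i.e. the vertices of $F$ are moved to the other cluster. -}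

module Defs where

open import Data.Nat using (ℕ; zero; suc; _+_)
open import Data.Bool using (Bool; true; false; not; if_then_else_)
open import Data.Fin using (Fin; zero; suc)
open import Data.Fin.Properties using (_≟_)
open import Relation.Nullary using (yes; no)
open import Relation.Binary.PropositionalEquality using (_≡_)

record Graph (n : ℕ) : Set where
  field
    adj       : Fin n → Fin n → Bool
    adj-sym   : ∀ u v → adj u v ≡ adj v u
    adj-irrefl : ∀ v → adj v v ≡ false
open Graph public

-- A 2-partition (V₁,V₂) of V, represented by the cluster-membership
-- function: π v = true iff v ∈ V₁ (so V₂ = {v | π v = false}).
-- Clusters may be empty. Conflicts are invariant under swapping V₁,V₂,
-- so this faithfully represents the unordered pair.
Partition : ℕ → Set
Partition n = Fin n → Bool

Σᶠ : ∀ {n} → (Fin n → ℕ) → ℕ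
Σᶠ {zero}  f = 0
Σᶠ {suc n} f = f zero + Σᶠ (λ i → f (suc i))

same : Bool → Bool → Bool
same true  b = b
same false b = not b

conflict : ∀ {n} → Graph n → Partition n → Fin n → Fin n → ℕ
conflict G π u v with u ≟ v
... | yes _ = 0
... | no _  = if same (π u) (π v)
                then (if adj G u v then 0 else 1)
                else (if adj G u v then 1 else 0)

c : ∀ {n} → Graph n → Partition n → Fin n → ℕ
c G π v = Σᶠ (λ u → conflict G π v u)

h₁ : ∀ {n} → Graph n → Partition n → ℕ
h₁ G π = Σᶠ (c G π)

flip : ∀ {n} → Partition n → Fin n → Partition n
flip π v u with u ≟ v
... | yes _ = not (π u)
... | no _  = π u

module Submission where

-- Fix a vertex v and let σ = π ⊖ {v}.  Moving v only changes the conflicts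
-- of pairs containing v, and conflicts are symmetric, so each changed
-- conflict is counted twice in h₁; this gives the exchange identity
--     h₁(σ) + 2·c_π(v) = h₁(π) + 2·c_σ(v).
-- Moreover every vertex u ≠ v is in conflict with v in exactly one of π
-- and σ, so c_π(v) + c_σ(v) = n - 1.  If h₁(π) ≤ h₁(σ), the first identity
-- gives c_π(v) ≤ c_σ(v), and then 2·c_π(v) ≤ c_π(v) + c_σ(v) = n - 1.

open import Defs
open import Data.Nat using (ℕ; zero; suc; _+_; _*_; _∸_; _≤_)
open import Data.Nat.Properties
  using (+-*-semiring; +-identityʳ; +-cancelˡ-≤; *-cancelˡ-≤; +-monoˡ-≤; +-monoʳ-≤; module ≤-Reasoning)
open import Data.Nat.Tactic.RingSolver using (solve-∀)
open import Data.Bool using (Bool; true; false; not; if_then_else_)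
open import Data.Fin using (Fin; zero; suc; punchIn)
open import Data.Fin.Properties using (_≟_; punchInᵢ≢i)
open import Data.Vec.Functional using (removeAt)
open import Function using (_∘_)
open import Relation.Nullary using (yes; no)
open import Relation.Nullary.Negation using (contradiction)
open import Relation.Binary.PropositionalEquality
  using (_≡_; _≢_; _≗_; refl; sym; trans; cong; cong₂; module ≡-Reasoning)
open import Algebra.Properties.Semiring.Sum +-*-semiring
  using (sum; sum-cong-≗; sum-remove; ∑-distrib-+)

-- Σᶠ is the standard library's finite sum over the semiring ℕ, which lets
-- us reuse its lemmas below.
Σᶠ≡sum : ∀ {n} (f : Fin n → ℕ) → Σᶠ f ≡ sum f
Σᶠ≡sum {zero}  f = refl
Σᶠ≡sum {suc n} f = cong (f zero +_) (Σᶠ≡sum (f ∘ suc))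

Σᶠ-cong : ∀ {n} {f g : Fin n → ℕ} → f ≗ g → Σᶠ f ≡ Σᶠ g
Σᶠ-cong {f = f} {g} f≗g =
  trans (Σᶠ≡sum f) (trans (sum-cong-≗ f≗g) (sym (Σᶠ≡sum g)))

Σᶠ-distrib-+ : ∀ {n} (f g : Fin n → ℕ) → Σᶠ (λ i → f i + g i) ≡ Σᶠ f + Σᶠ g
Σᶠ-distrib-+ f g = trans (Σᶠ≡sum (λ i → f i + g i))
  (trans (∑-distrib-+ f g) (sym (cong₂ _+_ (Σᶠ≡sum f) (Σᶠ≡sum g))))

Σᶠ-remove : ∀ {n} (f : Fin (suc n) → ℕ) (i : Fin (suc n)) →
            Σᶠ f ≡ f i + Σᶠ (removeAt f i)
Σᶠ-remove f i = trans (Σᶠ≡sum f)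
  (trans (sum-remove {i = i} f) (cong (f i +_) (sym (Σᶠ≡sum (removeAt f i)))))

Σᶠ-ones : ∀ n → Σᶠ {n} (λ _ → 1) ≡ n
Σᶠ-ones zero    = refl
Σᶠ-ones (suc n) = cong suc (Σᶠ-ones n)

clash : Bool → Bool → Bool → ℕ
clash a b e = if same a b then (if e then 0 else 1) else (if e then 1 else 0)

clash-sym : ∀ a b e → clash a b e ≡ clash b a e
clash-sym true  true  e = refl
clash-sym true  false e = refl
clash-sym false true  e = refl
clash-sym false false e = refl

clash-complement : ∀ a b e → clash a b e + clash (not a) b e ≡ 1
clash-complement true  true  true  = refl
clash-complement true  true  false = refl
clash-complement true  false true  = refl
clash-complement true  false false = refl
clash-complement false true  true  = refl
clash-complement false true  false = refl
clash-complement false false true  = refl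
clash-complement false false false = refl

module _ {n : ℕ} (G : Graph n) where

  conflict-self : ∀ π (u : Fin n) → conflict G π u u ≡ 0
  conflict-self π u with u ≟ u
  ... | yes _  = refl
  ... | no u≢u = contradiction refl u≢u

  conflict-distinct : ∀ π {u w : Fin n} → u ≢ w →
                      conflict G π u w ≡ clash (π u) (π w) (adj G u w)
  conflict-distinct π {u} {w} u≢w with u ≟ w
  ... | yes u≡w = contradiction u≡w u≢w
  ... | no _    = refl

  conflict-sym : ∀ π (u w : Fin n) → conflict G π u w ≡ conflict G π w u
  conflict-sym π u w with u ≟ w
  ... | yes refl = sym (conflict-self π u)
  ... | no u≢w = begin
    clash (π u) (π w) (adj G u w) ≡⟨ clash-sym (π u) (π w) (adj G u w) ⟩
    clash (π w) (π u) (adj G u w) ≡⟨ cong (clash (π w) (π u)) (adj-sym G u w) ⟩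
    clash (π w) (π u) (adj G w u) ≡⟨ sym (conflict-distinct π (u≢w ∘ sym)) ⟩
    conflict G π w u              ∎
    where open ≡-Reasoning

  conflict-local : ∀ π σ (u w : Fin n) → π u ≡ σ u → π w ≡ σ w →
                   conflict G π u w ≡ conflict G σ u w
  conflict-local π σ u w πu≡σu πw≡σw with u ≟ w
  ... | yes _ = refl
  ... | no _ rewrite πu≡σu | πw≡σw = refl

flip-self : ∀ {n} (π : Partition n) (v : Fin n) → flip π v v ≡ not (π v)
flip-self π v with v ≟ v
... | yes _  = refl
... | no v≢v = contradiction refl v≢v

flip-away : ∀ {n} (π : Partition n) {v u : Fin n} → u ≢ v → flip π v u ≡ π u
flip-away π {v} {u} u≢v with u ≟ v
... | yes u≡v = contradiction u≡v u≢v
... | no _    = refl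

-- Σ≠ v f: the sum of f over the indices other than v, which are
-- enumerated as punchIn v j (and punchInᵢ≢i says these differ from v).
Σ≠ : ∀ {m} → Fin (suc m) → (Fin (suc m) → ℕ) → ℕ
Σ≠ v f = Σᶠ (removeAt f v)

module _ {m : ℕ} (G : Graph (suc m)) where

  degree-as-column : ∀ π v → c G π v ≡ Σ≠ v (λ u → conflict G π u v)
  degree-as-column π v = begin
    Σᶠ (conflict G π v)       ≡⟨ Σᶠ-cong {g = column} (conflict-sym G π v) ⟩
    Σᶠ column                 ≡⟨ Σᶠ-remove column v ⟩
    column v + Σ≠ v column    ≡⟨ cong (_+ Σ≠ v column) (conflict-self G π v) ⟩
    Σ≠ v column               ∎
    where
    open ≡-Reasoning
    column : Fin (suc m) → ℕ
    column u = conflict G π u v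

  -- For u ≠ v, moving v changes c(u) only through the pair {u, v}.
  degree-elsewhere : ∀ π v {u} → u ≢ v →
    c G (flip π v) u + conflict G π u v ≡ c G π u + conflict G (flip π v) u v
  degree-elsewhere π v {u} u≢v = begin
    c G σ u + C u v                 ≡⟨ cong (_+ C u v) (Σᶠ-remove (C′ u) v) ⟩
    C′ u v + Σ≠ v (C′ u) + C u v    ≡⟨ cong (λ r → C′ u v + r + C u v) rest-unchanged ⟩
    C′ u v + Σ≠ v (C u) + C u v     ≡⟨ swap-outer (C′ u v) _ (C u v) ⟩
    C u v + Σ≠ v (C u) + C′ u v     ≡⟨ cong (_+ C′ u v) (sym (Σᶠ-remove (C u) v)) ⟩
    c G π u + C′ u v                ∎
    where
    open ≡-Reasoning
    σ = flip π v
    C = conflict G π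
    C′ = conflict G σ
    rest-unchanged : Σ≠ v (C′ u) ≡ Σ≠ v (C u)
    rest-unchanged = Σᶠ-cong λ j →
      conflict-local G σ π u (punchIn v j) (flip-away π u≢v) (flip-away π (punchInᵢ≢i v j))
    swap-outer : ∀ a r b → a + r + b ≡ b + r + a
    swap-outer = solve-∀

  exchange : ∀ π v →
    h₁ G (flip π v) + 2 * c G π v ≡ h₁ G π + 2 * c G (flip π v) v
  exchange π v = begin
    h₁ G σ + 2 * d          ≡⟨ cong (_+ 2 * d) (Σᶠ-remove (c G σ) v) ⟩
    d′ + A′ + 2 * d         ≡⟨ regroupˡ d d′ A′ ⟩
    d′ + d + (A′ + d)       ≡⟨ cong (d′ + d +_) others ⟩
    d′ + d + (A + d′)       ≡⟨ regroupʳ d d′ A ⟩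
    d + A + 2 * d′          ≡⟨ cong (_+ 2 * d′) (sym (Σᶠ-remove (c G π) v)) ⟩
    h₁ G π + 2 * d′         ∎
    where
    open ≡-Reasoning
    σ = flip π v
    d = c G π v
    d′ = c G σ v
    A = Σ≠ v (c G π)
    A′ = Σ≠ v (c G σ)
    others : A′ + d ≡ A + d′
    others = begin
      A′ + d                                           ≡⟨ cong (A′ +_) (degree-as-column π v) ⟩
      A′ + Σ≠ v (λ u → conflict G π u v)               ≡⟨ sym (Σᶠ-distrib-+ (removeAt (c G σ) v) _) ⟩
      Σ≠ v (λ u → c G σ u + conflict G π u v)          ≡⟨ Σᶠ-cong (λ j → degree-elsewhere π v (punchInᵢ≢i v j)) ⟩
      Σ≠ v (λ u → c G π u + conflict G σ u v)          ≡⟨ Σᶠ-distrib-+ (removeAt (c G π) v) (removeAt (λ u → conflict G σ u v) v) ⟩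
      A + Σ≠ v (λ u → conflict G σ u v)                ≡⟨ cong (A +_) (sym (degree-as-column σ v)) ⟩
      A + d′                                           ∎
    regroupˡ : ∀ d d′ A′ → d′ + A′ + 2 * d ≡ d′ + d + (A′ + d)
    regroupˡ = solve-∀
    regroupʳ : ∀ d d′ A → d′ + d + (A + d′) ≡ d + A + 2 * d′
    regroupʳ = solve-∀

  -- Every u ≠ v conflicts with v in exactly one of π and π ⊖ {v}.
  degrees-complementary : ∀ π v → c G π v + c G (flip π v) v ≡ m
  degrees-complementary π v = begin
    Σᶠ (C v) + Σᶠ (C′ v)                 ≡⟨ sym (Σᶠ-distrib-+ (C v) (C′ v)) ⟩
    Σᶠ (λ w → C v w + C′ v w)            ≡⟨ Σᶠ-remove (λ w → C v w + C′ v w) v ⟩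
    C v v + C′ v v + Σ≠ v (λ w → C v w + C′ v w)
      ≡⟨ drop-zeros (conflict-self G π v) (conflict-self G σ v) ⟩
    Σ≠ v (λ w → C v w + C′ v w)          ≡⟨ Σᶠ-cong (λ j → exactly-one (punchInᵢ≢i v j ∘ sym)) ⟩
    Σᶠ {m} (λ _ → 1)                     ≡⟨ Σᶠ-ones m ⟩
    m                                    ∎
    where
    open ≡-Reasoning
    σ = flip π v
    C = conflict G π
    C′ = conflict G σ
    drop-zeros : ∀ {a b r} → a ≡ 0 → b ≡ 0 → a + b + r ≡ r
    drop-zeros refl refl = refl
    exactly-one : ∀ {w} → v ≢ w → C v w + C′ v w ≡ 1
    exactly-one {w} v≢w = begin
      C v w + C′ v w
        ≡⟨ cong₂ _+_ (conflict-distinct G π v≢w) (conflict-distinct G σ v≢w) ⟩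
      clash (π v) (π w) (adj G v w) + clash (σ v) (σ w) (adj G v w)
        ≡⟨ cong (λ x → clash (π v) (π w) (adj G v w) + clash x (σ w) (adj G v w)) (flip-self π v) ⟩
      clash (π v) (π w) (adj G v w) + clash (not (π v)) (σ w) (adj G v w)
        ≡⟨ cong (λ x → clash (π v) (π w) (adj G v w) + clash (not (π v)) x (adj G v w)) (flip-away π (v≢w ∘ sym)) ⟩
      clash (π v) (π w) (adj G v w) + clash (not (π v)) (π w) (adj G v w)
        ≡⟨ clash-complement (π v) (π w) (adj G v w) ⟩
      1 ∎

lemma6 : (n : ℕ) (G : Graph n) (π : Partition n) →
         (∀ v → h₁ G π ≤ h₁ G (flip π v)) →
         ∀ v → 2 * c G π v ≤ n ∸ 1
lemma6 zero    G π optimal ()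
lemma6 (suc m) G π optimal v = begin
  2 * d      ≡⟨ cong (d +_) (+-identityʳ d) ⟩
  d + d      ≤⟨ +-monoʳ-≤ d d≤d′ ⟩
  d + d′     ≡⟨ degrees-complementary G π v ⟩
  m          ∎
  where
  open ≤-Reasoning
  d = c G π v
  d′ = c G (flip π v) v
  d≤d′ : d ≤ d′
  d≤d′ = *-cancelˡ-≤ 2 (+-cancelˡ-≤ (h₁ G π) _ _ (begin
    h₁ G π + 2 * d           ≤⟨ +-monoˡ-≤ (2 * d) (optimal v) ⟩
    h₁ G (flip π v) + 2 * d  ≡⟨ exchange G π v ⟩
    h₁ G π + 2 * d′          ∎))
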